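{- Let $\alpha>0$, $c>0$, and let $H$ be a $3$-uniform hypergraph with vertex set $[m]$ and $\alpha m^2$ edges, with co-degree at most $c$ (i.e. for every $i\ne j$ in $[m]$ the set $\{i,j\}$ is contained in at most $c$ edges). Then there is a subset $M\subseteq[m]$ with $|M|\ge\alpha m/(2c)$ such that every vertex of the sub-hypergraph of $H$ induced on $M$ has degree at least $\alpha m/2$.
   Context: A $3$-uniform hypergraph (called "3-regular hypergraph" in the paper) is one in which every edge is a set of exactly $3$ vertices. The sub-hypergraph induced on $M$ consists of the edges of $H$ entirely contained in $M$.
   Formalization: The co-degree bound c is taken to be a positive rational. -}

module Defs where

open import Data.Nat using (ℕ)
open import Data.Fin using (Fin)
open import Data.Fin.Subset using (Subset; _∈_; _⊆_; ∣_∣)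
open import Data.Fin.Subset.Properties using (_∈?_; _⊆?_)
open import Data.List using (List; length; filter)
open import Data.List.Relation.Unary.All using (All)
open import Data.List.Relation.Unary.Unique.Propositional using (Unique)
open import Data.Product using (_×_)
open import Relation.Binary.PropositionalEquality using (_≡_)
open import Relation.Nullary.Decidable using (_×-dec_)

record Hypergraph3 (m : ℕ) : Set where
  field
    edges   : List (Subset m)
    unique  : Unique edges
    uniform : All (λ e → ∣ e ∣ ≡ 3) edges
open Hypergraph3 public

numEdges : ∀ {m} → Hypergraph3 m → ℕ
numEdges H = length (edges H)

codeg : ∀ {m} → Hypergraph3 m → Fin m → Fin m → ℕ
codeg H i j = length (filter (λ e → (i ∈? e) ×-dec (j ∈? e)) (edges H))

inducedDeg : ∀ {m} → Hypergraph3 m → Subset m → Fin m → ℕ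
inducedDeg H M v = length (filter (λ e → (e ⊆? M) ×-dec (v ∈? e)) (edges H))

-- Greedy deletion: while some vertex of the current set M has induced degree
-- below E/(2m) (E the number of edges), delete it. Each deletion costs fewer
-- than E/(2m) edges, so even after m deletions fewer than E/2 edges are lost;
-- hence the final M still spans an edge and is non-empty, and all its
-- vertices have degree at least E/(2m). The degree of v is at most the sum of
-- the co-degrees of {v, u} over u ∈ M - v, i.e. at most c|M|, so |M| ≥ E/(2cm).
module Submission where

open import Defs
open import Data.Bool using (true; false; if_then_else_)
open import Data.Empty using (⊥-elim)
open import Data.Fin using (Fin; _≟_)
open import Data.Fin.Properties using (any?)
open import Data.Fin.Subset using (Subset; _∈_; _∉_; _⊆_; ∣_∣; _─_; _-_; ⁅_⁆; ⊤; Nonempty; inside; outside)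
open import Data.Fin.Subset.Properties
  using (_∈?_; _⊆?_; nonempty?; Empty-unique; ∣⊥∣≡0; ∣⁅x⁆∣≡1; ∣⊤∣≡n; ∣p∣≤n; p⊆q⇒∣p∣≤∣q∣; ⊆⊤;
         x∈⁅x⁆; x∉⁅y⁆⇒x≢y; x∈p∧x≢y⇒x∈p-y; x∈p⇒∣p-x∣<∣p∣)
open import Data.List using (List; []; _∷_; length; filter; map)
open import Data.List.Properties using (length-map; filter-all; map-cong)
open import Data.List.Membership.Propositional using () renaming (_∈_ to _∈ₗ_)
open import Data.List.Membership.Propositional.Properties using (∈-map⁺; ∈-map⁻; ∈-filter⁻)
open import Data.List.Relation.Unary.All as All using (All; _∷_)
open import Data.List.Relation.Unary.Any using (here; there)
open import Data.Nat using (ℕ; zero; suc; _+_; _*_; _≤_; _<_; _≤?_; z≤n; s≤s)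
open import Data.Nat.Induction using (<-wellFounded)
open import Data.Nat.ListAction using (sum)
open import Data.Nat.Properties hiding (_≟_)
open import Algebra.Properties.CommutativeSemigroup +-commutativeSemigroup using (interchange)
open import Data.Nat.Solver using (module +-*-Solver)
open import Data.Product using (Σ; ∃; _×_; _,_)
open import Data.Sum using (_⊎_; inj₁; inj₂)
import Data.Vec as Vec
open import Function using (_∘′_)
open import Induction.WellFounded using (Acc; acc)
open import Level using (Level)
open import Relation.Binary.PropositionalEquality using (_≡_; _≢_; refl; sym; trans; cong; cong₂; subst)
open import Relation.Nullary using (yes; no; ¬_; does)
open import Relation.Nullary.Decidable using (_×-dec_; ¬?; decidable-stable)
open import Relation.Unary using (Pred; Decidable)

open +-*-Solver using (solve; _:+_; _:*_; _:=_; con)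

private variable
  a ℓ ℓ′ ℓ″ : Level
  A B : Set a
  n : ℕ

indicator : {P : Pred A ℓ} → Decidable P → A → ℕ
indicator P? x = if does (P? x) then 1 else 0

length-filter-∷ : {P : Pred A ℓ} (P? : Decidable P) (x : A) (xs : List A) →
                  length (filter P? (x ∷ xs)) ≡ indicator P? x + length (filter P? xs)
length-filter-∷ P? x xs with does (P? x)
... | true  = refl
... | false = refl

length-filter-≤-+ : {P : Pred A ℓ} {Q : Pred A ℓ′} {R : Pred A ℓ″}
                    (P? : Decidable P) (Q? : Decidable Q) (R? : Decidable R) →
                    (∀ {x} → P x → Q x ⊎ R x) → (xs : List A) →
                    length (filter P? xs) ≤ length (filter Q? xs) + length (filter R? xs)
length-filter-≤-+ P? Q? R? P⇒Q⊎R [] = z≤n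
length-filter-≤-+ P? Q? R? P⇒Q⊎R (x ∷ xs) = begin
  length (filter P? (x ∷ xs))
    ≡⟨ length-filter-∷ P? x xs ⟩
  indicator P? x + #P
    ≤⟨ +-mono-≤ indicator-≤ (length-filter-≤-+ P? Q? R? P⇒Q⊎R xs) ⟩
  (indicator Q? x + indicator R? x) + (#Q + #R)
    ≡⟨ interchange (indicator Q? x) (indicator R? x) #Q #R ⟩
  (indicator Q? x + #Q) + (indicator R? x + #R)
    ≡⟨ sym (cong₂ _+_ (length-filter-∷ Q? x xs) (length-filter-∷ R? x xs)) ⟩
  length (filter Q? (x ∷ xs)) + length (filter R? (x ∷ xs)) ∎
  where
  open ≤-Reasoning
  #P = length (filter P? xs)
  #Q = length (filter Q? xs)
  #R = length (filter R? xs)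
  indicator-≤ : indicator P? x ≤ indicator Q? x + indicator R? x
  indicator-≤ with P? x | Q? x | R? x
  ... | no _  | _     | _     = z≤n
  ... | yes _ | yes _ | _     = s≤s z≤n
  ... | yes _ | no _  | yes _ = s≤s z≤n
  ... | yes p | no ¬q | no ¬r with P⇒Q⊎R p
  ...   | inj₁ q = ⊥-elim (¬q q)
  ...   | inj₂ r = ⊥-elim (¬r r)

sum-map-+ : (f g : B → ℕ) (us : List B) →
            sum (map (λ u → f u + g u) us) ≡ sum (map f us) + sum (map g us)
sum-map-+ f g []       = refl
sum-map-+ f g (u ∷ us) rewrite sum-map-+ f g us = interchange (f u) (g u) _ _

sum-map-*-≤ : (f : B → ℕ) {q p : ℕ} (us : List B) → (∀ {u} → u ∈ₗ us → f u * q ≤ p) →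
              sum (map f us) * q ≤ length us * p
sum-map-*-≤ f []       bound = z≤n
sum-map-*-≤ f {q} (u ∷ us) bound rewrite *-distribʳ-+ q (f u) (sum (map f us)) =
  +-mono-≤ (bound (here refl)) (sum-map-*-≤ f us (bound ∘′ there))

1≤sum-indicator : {Q : B → Pred A ℓ} (Q? : ∀ u → Decidable (Q u)) (x : A) {us : List B} {u : B} →
                  u ∈ₗ us → Q u x → 1 ≤ sum (map (λ u → indicator (Q? u) x) us)
1≤sum-indicator Q? x {u ∷ _} (here refl) q with Q? u x
... | yes _ = s≤s z≤n
... | no ¬q = ⊥-elim (¬q q)
1≤sum-indicator Q? x {w ∷ _} (there u∈us) q =
  ≤-trans (1≤sum-indicator Q? x u∈us q) (m≤n+m _ (indicator (Q? w) x))

length-filter-≤-sum : {P : Pred A ℓ} {Q : B → Pred A ℓ′}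
                      (P? : Decidable P) (Q? : ∀ u → Decidable (Q u)) (us : List B) (xs : List A) →
                      (∀ {x} → x ∈ₗ xs → P x → ∃ λ u → u ∈ₗ us × Q u x) →
                      length (filter P? xs) ≤ sum (map (λ u → length (filter (Q? u) xs)) us)
length-filter-≤-sum P? Q? us []       covered = z≤n
length-filter-≤-sum P? Q? us (x ∷ xs) covered = begin
  length (filter P? (x ∷ xs))
    ≡⟨ length-filter-∷ P? x xs ⟩
  indicator P? x + length (filter P? xs)
    ≤⟨ +-mono-≤ indicator-≤ (length-filter-≤-sum P? Q? us xs (covered ∘′ there)) ⟩
  sum (map (λ u → indicator (Q? u) x) us) + sum (map (λ u → length (filter (Q? u) xs)) us)
    ≡⟨ sym (sum-map-+ (λ u → indicator (Q? u) x) (λ u → length (filter (Q? u) xs)) us) ⟩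
  sum (map (λ u → indicator (Q? u) x + length (filter (Q? u) xs)) us)
    ≡⟨ sym (cong sum (map-cong (λ u → length-filter-∷ (Q? u) x xs) us)) ⟩
  sum (map (λ u → length (filter (Q? u) (x ∷ xs))) us) ∎
  where
  open ≤-Reasoning
  indicator-≤ : indicator P? x ≤ sum (map (λ u → indicator (Q? u) x) us)
  indicator-≤ with P? x
  ... | no _  = z≤n
  ... | yes p with covered (here refl) p
  ...   | u , u∈us , q = 1≤sum-indicator Q? x u∈us q

∃-∈-filter : {P : Pred A ℓ} (P? : Decidable P) (xs : List A) →
             0 < length (filter P? xs) → ∃ λ x → x ∈ₗ xs × P x
∃-∈-filter P? xs 0<# with filter P? xs in eq
... | x ∷ _ = x , ∈-filter⁻ P? (subst (x ∈ₗ_) (sym eq) (here refl))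

elements : Subset n → List (Fin n)
elements Vec.[]           = []
elements (inside  Vec.∷ p) = Fin.zero ∷ map Fin.suc (elements p)
elements (outside Vec.∷ p) = map Fin.suc (elements p)

length-elements : (p : Subset n) → length (elements p) ≡ ∣ p ∣
length-elements Vec.[]            = refl
length-elements (inside  Vec.∷ p) = cong suc (trans (length-map Fin.suc (elements p)) (length-elements p))
length-elements (outside Vec.∷ p) = trans (length-map Fin.suc (elements p)) (length-elements p)

∈-elements⁺ : (p : Subset n) {x : Fin n} → x ∈ p → x ∈ₗ elements p
∈-elements⁺ (inside  Vec.∷ p) Vec.here        = here refl
∈-elements⁺ (inside  Vec.∷ p) (Vec.there x∈p) = there (∈-map⁺ Fin.suc (∈-elements⁺ p x∈p))
∈-elements⁺ (outside Vec.∷ p) (Vec.there x∈p) = ∈-map⁺ Fin.suc (∈-elements⁺ p x∈p)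

∈-elements⁻ : (p : Subset n) {x : Fin n} → x ∈ₗ elements p → x ∈ p
∈-elements⁻ (inside  Vec.∷ p) (here refl) = Vec.here
∈-elements⁻ (inside  Vec.∷ p) (there x∈) with ∈-map⁻ Fin.suc x∈
... | y , y∈ , refl = Vec.there (∈-elements⁻ p y∈)
∈-elements⁻ (outside Vec.∷ p) x∈ with ∈-map⁻ Fin.suc x∈
... | y , y∈ , refl = Vec.there (∈-elements⁻ p y∈)

x∈p─q⇒x∉q : (p q : Subset n) {x : Fin n} → x ∈ p ─ q → x ∉ q
x∈p─q⇒x∉q (inside Vec.∷ p) (outside Vec.∷ q) Vec.here ()
x∈p─q⇒x∉q (_ Vec.∷ p) (_ Vec.∷ q) (Vec.there x∈) (Vec.there x∈q) = x∈p─q⇒x∉q p q x∈ x∈q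

x∈p-y⇒x≢y : (p : Subset n) {x y : Fin n} → x ∈ p - y → x ≢ y
x∈p-y⇒x≢y p {y = y} x∈ = x∉⁅y⁆⇒x≢y (x∈p─q⇒x∉q p ⁅ y ⁆ x∈)

0<∣p∣⇒Nonempty : (p : Subset n) → 0 < ∣ p ∣ → Nonempty p
0<∣p∣⇒Nonempty {n} p 0<∣p∣ with nonempty? p
... | yes ne = ne
... | no ¬ne = ⊥-elim (<⇒≢ 0<∣p∣ (sym (trans (cong ∣_∣ (Empty-unique ¬ne)) (∣⊥∣≡0 n))))

1<∣p∣⇒∃≢ : (p : Subset n) → 1 < ∣ p ∣ → (y : Fin n) → ∃ λ x → x ∈ p × x ≢ y
1<∣p∣⇒∃≢ p 1<∣p∣ y with any? (λ x → (x ∈? p) ×-dec ¬? (x ≟ y))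
... | yes found = found
... | no ¬found = ⊥-elim (<⇒≱ 1<∣p∣ (subst (∣ p ∣ ≤_) (∣⁅x⁆∣≡1 y) (p⊆q⇒∣p∣≤∣q∣ p⊆⁅y⁆)))
  where
  p⊆⁅y⁆ : p ⊆ ⁅ y ⁆
  p⊆⁅y⁆ {x} x∈p with x ≟ y
  ... | yes refl = x∈⁅x⁆ x
  ... | no x≢y  = ⊥-elim (¬found (x , x∈p , x≢y))

module _ {Inv : Pred (Subset n) ℓ} {R : Subset n → Pred (Fin n) ℓ′} (R? : ∀ M → Decidable (R M))
         (Inv-remove : ∀ {M v} → v ∈ M → ¬ R M v → Inv M → Inv (M - v)) where

  prune : (M : Subset n) → Inv M → Σ (Subset n) λ M′ → Inv M′ × (∀ v → v ∈ M′ → R M′ v)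
  prune M = go M (<-wellFounded ∣ M ∣)
    where
    go : (M : Subset n) → Acc _<_ ∣ M ∣ → Inv M → Σ (Subset n) λ M′ → Inv M′ × (∀ v → v ∈ M′ → R M′ v)
    go M (acc smaller) inv with any? (λ v → (v ∈? M) ×-dec ¬? (R? M v))
    ... | yes (v , v∈M , ¬Rv) = go (M - v) (smaller (x∈p⇒∣p-x∣<∣p∣ v∈M)) (Inv-remove v∈M ¬Rv inv)
    ... | no ∄bad = M , inv , λ v v∈M → decidable-stable (R? M v) (λ ¬Rv → ∄bad (v , v∈M , ¬Rv))

module _ {m : ℕ} (H : Hypergraph3 m) where

  edge-size : {e : Subset m} → e ∈ₗ edges H → ∣ e ∣ ≡ 3
  edge-size = All.lookup (uniform H)

  numEdges-pos⇒3≤m : 0 < numEdges H → 3 ≤ m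
  numEdges-pos⇒3≤m 0<E with edges H | uniform H
  ... | e ∷ _ | ∣e∣≡3 ∷ _ = subst (_≤ m) ∣e∣≡3 (∣p∣≤n e)

  numEdgesWithin : Subset m → ℕ
  numEdgesWithin M = length (filter (_⊆? M) (edges H))

  numEdgesWithin-⊤ : numEdgesWithin ⊤ ≡ numEdges H
  numEdgesWithin-⊤ = cong length (filter-all (_⊆? ⊤) (All.universal (λ _ {_} → ⊆⊤) (edges H)))

  numEdgesWithin-remove : (M : Subset m) (v : Fin m) →
                          numEdgesWithin M ≤ numEdgesWithin (M - v) + inducedDeg H M v
  numEdgesWithin-remove M v =
    length-filter-≤-+ (_⊆? M) (_⊆? (M - v)) (λ e → (e ⊆? M) ×-dec (v ∈? e)) split (edges H)
    where
    split : ∀ {e} → e ⊆ M → e ⊆ M - v ⊎ (e ⊆ M × v ∈ e)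
    split {e} e⊆M with v ∈? e
    ... | yes v∈e = inj₂ (e⊆M , v∈e)
    ... | no v∉e  = inj₁ λ u∈e → x∈p∧x≢y⇒x∈p-y (e⊆M u∈e) λ { refl → v∉e u∈e }

  spansEdge⇒Nonempty : (M : Subset m) → 0 < numEdgesWithin M → Nonempty M
  spansEdge⇒Nonempty M 0<e with ∃-∈-filter (_⊆? M) (edges H) 0<e
  ... | e , e∈E , e⊆M with 0<∣p∣⇒Nonempty e (subst (0 <_) (sym (edge-size e∈E)) (s≤s z≤n))
  ...   | v , v∈e = v , e⊆M v∈e

  inducedDeg-bound : {p q : ℕ} → (∀ i j → i ≢ j → codeg H i j * q ≤ p) →
                     (M : Subset m) (v : Fin m) → inducedDeg H M v * q ≤ ∣ M - v ∣ * p
  inducedDeg-bound {p} {q} codeg≤ M v = begin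
    inducedDeg H M v * q
      ≤⟨ *-monoˡ-≤ q (length-filter-≤-sum _ (λ u e → (v ∈? e) ×-dec (u ∈? e)) others (edges H) covered) ⟩
    sum (map (codeg H v) others) * q
      ≤⟨ sum-map-*-≤ (codeg H v) others (λ u∈ → codeg≤ v _ (x∈p-y⇒x≢y M (∈-elements⁻ (M - v) u∈) ∘′ sym)) ⟩
    length others * p
      ≡⟨ cong (_* p) (length-elements (M - v)) ⟩
    ∣ M - v ∣ * p ∎
    where
    open ≤-Reasoning
    others = elements (M - v)
    covered : ∀ {e} → e ∈ₗ edges H → e ⊆ M × v ∈ e → ∃ λ u → u ∈ₗ others × (v ∈ e × u ∈ e)
    covered e∈E (e⊆M , v∈e) with 1<∣p∣⇒∃≢ _ (subst (1 <_) (sym (edge-size e∈E)) (s≤s (s≤s z≤n))) v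
    ... | u , u∈e , u≢v = u , ∈-elements⁺ (M - v) (x∈p∧x≢y⇒x∈p-y (e⊆M u∈e) u≢v) , v∈e , u∈e

  -- 2m(E − e(M)) ≤ (m − |M|)E, where e = numEdgesWithin, rearranged to avoid truncated
  -- subtraction: on average each vertex deleted so far cost at most E/(2m) edges.
  FewEdgesLost : Subset m → Set
  FewEdgesLost M = 2 * m * numEdges H + ∣ M ∣ * numEdges H ≤ 2 * m * numEdgesWithin M + m * numEdges H

  fewEdgesLost-⊤ : FewEdgesLost ⊤
  fewEdgesLost-⊤ rewrite numEdgesWithin-⊤ | ∣⊤∣≡n m = ≤-refl

  fewEdgesLost-remove : ∀ {M v} → v ∈ M → ¬ (numEdges H ≤ 2 * m * inducedDeg H M v) →
                        FewEdgesLost M → FewEdgesLost (M - v)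
  fewEdgesLost-remove {M} {v} v∈M low lost = +-cancelʳ-≤ E (K * E + ∣ M - v ∣ * E) (K * e′ + m * E) (begin
    K * E + ∣ M - v ∣ * E + E    ≡⟨ +-assoc (K * E) _ E ⟩
    K * E + (∣ M - v ∣ * E + E)  ≡⟨ cong (K * E +_) (+-comm _ E) ⟩
    K * E + suc ∣ M - v ∣ * E    ≤⟨ +-monoʳ-≤ (K * E) (*-monoˡ-≤ E (x∈p⇒∣p-x∣<∣p∣ v∈M)) ⟩
    K * E + ∣ M ∣ * E            ≤⟨ lost ⟩
    K * numEdgesWithin M + m * E ≤⟨ +-monoˡ-≤ (m * E) (*-monoʳ-≤ K (numEdgesWithin-remove M v)) ⟩
    K * (e′ + d) + m * E         ≡⟨ solve 4 (λ K e′ d mE → K :* (e′ :+ d) :+ mE := K :* e′ :+ mE :+ K :* d)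
                                          refl K e′ d (m * E) ⟩
    K * e′ + m * E + K * d       ≤⟨ +-monoʳ-≤ (K * e′ + m * E) (<⇒≤ (≰⇒> low)) ⟩
    K * e′ + m * E + E           ∎)
    where
    open ≤-Reasoning
    E = numEdges H
    K = 2 * m
    e′ = numEdgesWithin (M - v)
    d = inducedDeg H M v

  fewEdgesLost⇒spansEdge : 0 < numEdges H → (M : Subset m) → FewEdgesLost M → 0 < numEdgesWithin M
  fewEdgesLost⇒spansEdge 0<E M lost with numEdgesWithin M
  ... | suc _ = s≤s z≤n
  ... | zero  = ⊥-elim (<⇒≱ (*-mono-< 0<m 0<E) (+-cancelʳ-≤ (m * E) (m * E) 0 (begin
    m * E + m * E              ≡⟨ solve 2 (λ m E → m :* E :+ m :* E := con 2 :* m :* E) refl m E ⟩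
    2 * m * E                  ≤⟨ m≤m+n (2 * m * E) (∣ M ∣ * E) ⟩
    2 * m * E + ∣ M ∣ * E      ≤⟨ lost ⟩
    2 * m * 0 + m * E          ≡⟨ cong (_+ m * E) (*-zeroʳ (2 * m)) ⟩
    0 + m * E                  ∎)))
    where
    open ≤-Reasoning
    E = numEdges H
    0<m : 0 < m
    0<m = ≤-trans (s≤s z≤n) (numEdges-pos⇒3≤m 0<E)

degreeBounds⇒sizeBound : ∀ m p d s {E q} → E ≤ 2 * m * d → d * q ≤ s * p → E * q ≤ 2 * p * m * s
degreeBounds⇒sizeBound m p d s {E} {q} E≤ dq≤ = begin
  E * q           ≤⟨ *-monoˡ-≤ q E≤ ⟩
  2 * m * d * q   ≡⟨ *-assoc (2 * m) d q ⟩
  2 * m * (d * q) ≤⟨ *-monoʳ-≤ (2 * m) dq≤ ⟩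
  2 * m * (s * p) ≡⟨ solve 3 (λ m s p → con 2 :* m :* (s :* p) := con 2 :* p :* m :* s) refl m s p ⟩
  2 * p * m * s   ∎
  where open ≤-Reasoning

lemma4p9 : (m p q : ℕ) → 0 < p → 0 < q → (H : Hypergraph3 m)
    → 0 < numEdges H
    → (∀ (i j : Fin m) → i ≢ j → codeg H i j * q ≤ p)
    → Σ (Subset m) (λ M →
        (numEdges H * q ≤ 2 * p * m * ∣ M ∣)
        × (∀ v → v ∈ M → numEdges H ≤ 2 * m * inducedDeg H M v))
lemma4p9 m p q _ _ H 0<E codeg≤
  with prune (λ M v → numEdges H ≤? 2 * m * inducedDeg H M v) (fewEdgesLost-remove H) ⊤ (fewEdgesLost-⊤ H)
... | M , lost , highDeg
  with spansEdge⇒Nonempty H M (fewEdgesLost⇒spansEdge H 0<E M lost)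
... | v , v∈M = M , degreeBounds⇒sizeBound m p _ ∣ M ∣ (highDeg v v∈M) deg-bound , highDeg
  where
  deg-bound : inducedDeg H M v * q ≤ ∣ M ∣ * p
  deg-bound = ≤-trans (inducedDeg-bound H codeg≤ M v) (*-monoˡ-≤ p (<⇒≤ (x∈p⇒∣p-x∣<∣p∣ v∈M)))
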